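{- Let $X\subseteq2^\omega$ and suppose $X=\bigcup_{n<\omega}X_n$. Then $$\mathcal{F}_X=\Big\{\bigcup_{n<\omega}a_n : a_n\in\mathcal{F}_{X_n}\text{ for all }n<\omega\Big\}.$$
   Context: Subsets of $\omega$ are identified with elements of $2^\omega$. For distinct $x,y\in2^\omega$ let $h(x,y)=\min\{n:x(n)\ne y(n)\}$; for $X\subseteq2^\omega$, $H(X)=\{h(x,y):x,y\in X,x\ne y\}$. The Raisonnier filter $\mathcal{F}_X$ is the set of all $a\subseteq\omega$ for which there is a countable family $\{Y_n:n<\omega\}$ of subsets of $2^\omega$ with $X\subseteq\bigcup_nY_n$ and $a\supseteq\bigcup_nH(Y_n)$. -}

module Defs where

open import Level using (Level; suc)
open import Data.Nat using (ℕ; _<_)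
open import Data.Bool using (Bool; true)
open import Data.Product using (Σ; ∃; _×_)
open import Relation.Binary.PropositionalEquality using (_≡_; _≢_)
open import Relation.Nullary using (¬_)
open import Relation.Unary using (Pred)

-- 2^ω ; subsets of ω are identified with elements of 2^ω
Cantor : Set
Cantor = ℕ → Bool

hIs : Cantor → Cantor → ℕ → Set
hIs x y n = (∀ m → m < n → x m ≡ y m) × (x n ≢ y n)

H : ∀ {ℓ} → Pred Cantor ℓ → Pred ℕ ℓ
H Y n = Σ Cantor λ x → Σ Cantor λ y → Y x × Y y × ¬ (x ≡ y) × hIs x y n

F : ∀ {ℓ} → Pred Cantor ℓ → Pred Cantor (suc ℓ)
F {ℓ} X a = Σ (ℕ → Pred Cantor ℓ) λ Y →
  (∀ x → X x → ∃ λ n → Y n x) × (∀ n k → H (Y n) k → a k ≡ true)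

{-# OPTIONS --safe #-}
-- If a_n ∈ F_{X_n} is witnessed by the cover (Y_{n,m})_m, then re-indexing the doubly
-- indexed family (Y_{n,m}) along a surjection ℕ → ℕ × ℕ gives a single countable cover
-- of X = ⋃ X_n all of whose H-sets lie in ⋃ a_n; so F_X is closed under such unions.
-- Conversely a ∈ F_X lies in every F_{X_n} because X_n ⊆ X, and a = ⋃ (a, a, …).
module Submission where

open import Defs
open import Level using (Level)
open import Data.Nat using (ℕ; zero; suc; _+_)
open import Data.Nat.Properties using (+-suc; +-identityʳ)
open import Data.Bool using (true)
open import Data.Product using (Σ; ∃; _×_; _,_; proj₁; proj₂; uncurry)
open import Relation.Binary.PropositionalEquality using (_≡_; refl; cong; sym; trans; subst)
open import Relation.Unary using (Pred; _⊆_; ⋃)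
open import Function.Bundles using (_⇔_; mk⇔; Equivalence)

-- unpair enumerates ℕ × ℕ diagonal by diagonal: (0,d), (1,d-1), …, (d,0), (0,d+1), …
next : ℕ × ℕ → ℕ × ℕ
next (i , zero)  = (zero , suc i)
next (i , suc j) = (suc i , j)

unpair : ℕ → ℕ × ℕ
unpair zero    = (zero , zero)
unpair (suc k) = next (unpair k)

unpair-along-diagonal : ∀ i j k → unpair k ≡ (zero , i + j) → unpair (i + k) ≡ (i , j)
unpair-along-diagonal zero    j k eq = eq
unpair-along-diagonal (suc i) j k eq =
  cong next (unpair-along-diagonal i (suc j) k (trans eq (cong (zero ,_) (sym (+-suc i j)))))

unpair-diagonal-start : ∀ d → ∃ λ k → unpair k ≡ (zero , d)
unpair-diagonal-start zero    = zero , refl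
unpair-diagonal-start (suc d) =
  let k , eq = unpair-diagonal-start d
  in suc (d + k) , cong next (unpair-along-diagonal d zero k (trans eq (cong (zero ,_) (sym (+-identityʳ d)))))

unpair-surjective : ∀ i j → ∃ λ k → unpair k ≡ (i , j)
unpair-surjective i j =
  let k , eq = unpair-diagonal-start (i + j)
  in i + k , unpair-along-diagonal i j k eq

module _ {ℓ : Level} where

  F-antitone : {X X′ : Pred Cantor ℓ} {a : Cantor} → X ⊆ X′ → F X′ a → F X a
  F-antitone X⊆X′ (Y , cover , bound) = Y , (λ x x∈X → cover x (X⊆X′ x∈X)) , bound

  F-upward-closed : {X : Pred Cantor ℓ} {a b : Cantor} →
    (∀ k → a k ≡ true → b k ≡ true) → F X a → F X b
  F-upward-closed a⊆b (Y , cover , bound) = Y , cover , λ n k h → a⊆b k (bound n k h)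

  F-σ-additive : {X : Pred Cantor ℓ} {Xs : ℕ → Pred Cantor ℓ} {a : Cantor} →
    X ⊆ ⋃ ℕ Xs → (∀ n → F (Xs n) a) → F X a
  F-σ-additive {X} {Xs} {a} X⊆⋃Xs Fa = Y , cover , bound
    where
    Ys : ℕ → ℕ → Pred Cantor ℓ
    Ys n = proj₁ (Fa n)

    Y : ℕ → Pred Cantor ℓ
    Y k = uncurry Ys (unpair k)

    cover : ∀ x → X x → ∃ λ k → Y k x
    cover x x∈X =
      let n , x∈Xn = X⊆⋃Xs x∈X
          m , x∈Ynm = proj₁ (proj₂ (Fa n)) x x∈Xn
          k , unpair-k = unpair-surjective n m
      in k , subst (λ p → uncurry Ys p x) (sym unpair-k) x∈Ynm

    bound : ∀ k i → H (Y k) i → a i ≡ true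
    bound k = proj₂ (proj₂ (Fa (proj₁ (unpair k)))) (proj₂ (unpair k))

proposition3p2 : ∀ {ℓ} (X : Pred Cantor ℓ) (Xs : ℕ → Pred Cantor ℓ) →
    (∀ x → X x ⇔ (∃ λ n → Xs n x)) →
    ∀ (a : Cantor) →
      F X a ⇔ (Σ (ℕ → Cantor) λ as →
                 (∀ n → F (Xs n) (as n)) ×
                 (∀ k → a k ≡ true ⇔ (∃ λ n → as n k ≡ true)))
proposition3p2 X Xs X⇔⋃Xs a = mk⇔ restrict combine
  where
  UnionOfFs : Set _
  UnionOfFs = Σ (ℕ → Cantor) λ as →
                (∀ n → F (Xs n) (as n)) × (∀ k → a k ≡ true ⇔ (∃ λ n → as n k ≡ true))

  X⊆⋃Xs : X ⊆ ⋃ ℕ Xs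
  X⊆⋃Xs = Equivalence.to (X⇔⋃Xs _)

  Xn⊆X : ∀ n → Xs n ⊆ X
  Xn⊆X n x∈Xn = Equivalence.from (X⇔⋃Xs _) (n , x∈Xn)

  restrict : F X a → UnionOfFs
  restrict Fa = (λ _ → a) , (λ n → F-antitone (Xn⊆X n) Fa) , λ k → mk⇔ (zero ,_) proj₂

  combine : UnionOfFs → F X a
  combine (as , Fas , a⇔⋃as) =
    F-σ-additive X⊆⋃Xs λ n → F-upward-closed (λ k ask → Equivalence.from (a⇔⋃as k) (n , ask)) (Fas n)
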